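{- Let $m\ge0$ and let $a$ be an atom of $\breve\Omega^{(2)}_{2m+1}$. Then for every $k\ge 0$, $$\#\{\omega\in[a,\hat1]:\operatorname{crk}\omega=k\}=\binom{m+k}{2k}.$$
   Context: An ordered set partition of $[n]=\{1,\ldots,n\}$ is a sequence $(B_1,\ldots,B_k)$ of nonempty disjoint blocks with union $[n]$. Ordered set partitions are partially ordered by letting $(B_1,\ldots,B_k)$ be covered by each $(B_1,\ldots,B_{i-1},B_i\cup B_{i+1},B_{i+2},\ldots,B_k)$ and taking the transitive closure (so $\omega\le\psi$ iff every block of $\psi$ is a union of consecutive blocks of $\omega$, in order). $\breve\Omega^{(d)}_n$ is the subposet of ordered set partitions of $[n]$ all of whose block sizes are congruent to $1$ modulo $d$, with a new minimum $\hat0$ adjoined. For $n=2m+1$ and $d=2$ it is graded with maximum $\hat1=([2m+1])$, and $\operatorname{crk}\omega=\operatorname{rk}\hat1-\operatorname{rk}\omega$, where rank is the length of maximal chains from $\hat0$. -}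

module Defs where

open import Data.Nat using (ℕ; zero; suc; _+_; _*_; _≤ᵇ_; _≡ᵇ_; _%_; NonZero)
open import Data.Nat.Properties using (+-comm; *-comm)
open import Data.Nat.DivMod using ([m+kn]%n≡m%n)
open import Data.Bool using (Bool; true; false; T; _∧_)
open import Data.Fin using (Fin) renaming (_≟_ to _≟F_)
import Data.Fin as F
open import Data.Vec using (Vec; []; _∷_; count; map; replicate)
open import Data.List using (List; []; _∷_; allFin)
open import Data.Maybe using (Maybe; just; nothing)
open import Data.Product using (Σ; ∃; _×_; _,_)
open import Relation.Binary.PropositionalEquality using (_≡_; _≢_; refl; cong; subst)
open import Relation.Nullary using (¬_)

-- An ordered set partition (B_0,…,B_{k-1}) is encoded canonically by the
-- vector f : Vec (Fin k) n with f[x] = index of the block containing x.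
-- Validity (checked by a boolean, so the proof component is irrelevant):
-- every block is nonempty and its size is ≡ 1 (mod d).

allᵇ : ∀ {A : Set} → (A → Bool) → List A → Bool
allᵇ p [] = true
allᵇ p (x ∷ xs) = p x ∧ allᵇ p xs

blockSize : ∀ {n k} → Vec (Fin k) n → Fin k → ℕ
blockSize v i = count (λ j → j ≟F i) v

validᵇ : (d : ℕ) .{{_ : NonZero d}} → ∀ {n k} → Vec (Fin k) n → Bool
validᵇ d {k = k} v =
  allᵇ (λ i → (1 ≤ᵇ blockSize v i) ∧ ((blockSize v i % d) ≡ᵇ (1 % d))) (allFin k)

record OSP (d : ℕ) .{{_ : NonZero d}} (n : ℕ) : Set where
  constructor osp
  field
    nblocks : ℕ
    blocks  : Vec (Fin nblocks) n
    valid   : T (validᵇ d blocks)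
open OSP public

-- ω ≤ ψ  iff every block of ψ is a union of consecutive blocks of ω, in
-- order: ψ's block map is g ∘ (ω's block map) for a weakly
-- order-preserving g : Fin k → Fin l.
_≤O_ : ∀ {d} .{{_ : NonZero d}} {n} → OSP d n → OSP d n → Set
ω ≤O ψ = Σ (Fin (nblocks ω) → Fin (nblocks ψ)) λ g →
  (∀ i j → i F.≤ j → g i F.≤ g j) × (blocks ψ ≡ map g (blocks ω))

Ω̆ : (d : ℕ) .{{_ : NonZero d}} (n : ℕ) → Set
Ω̆ d n = Maybe (OSP d n)

0̂ : ∀ {d} .{{_ : NonZero d}} {n} → Ω̆ d n
0̂ = nothing

_≤Ω_ : ∀ {d} .{{_ : NonZero d}} {n} → Ω̆ d n → Ω̆ d n → Set
nothing ≤Ω y      = Data.Unit.⊤ where import Data.Unit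
just x  ≤Ω nothing = Data.Empty.⊥ where import Data.Empty
just x  ≤Ω just y  = x ≤O y

_<Ω_ : ∀ {d} .{{_ : NonZero d}} {n} → Ω̆ d n → Ω̆ d n → Set
x <Ω y = (x ≤Ω y) × (x ≢ y)

_⋖_ : ∀ {d} .{{_ : NonZero d}} {n} → Ω̆ d n → Ω̆ d n → Set
_⋖_ {d} {n} x y = (x <Ω y) × (¬ (Σ (Ω̆ d n) λ z → (x <Ω z) × (z <Ω y)))

IsAtom : ∀ {d} .{{_ : NonZero d}} {n} → Ω̆ d n → Set
IsAtom a = 0̂ ⋖ a

data SatChain {d} .{{_ : NonZero d}} {n} : Ω̆ d n → Ω̆ d n → ℕ → Set where
  done : ∀ {x} → SatChain x x 0
  step : ∀ {x z y r} → x ⋖ z → SatChain z y r → SatChain x y (suc r)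

-- rk x = r : r is the length of a maximal chain of [0̂, x]
-- (well defined as the poset is graded).
HasRank : ∀ {d} .{{_ : NonZero d}} {n} → Ω̆ d n → ℕ → Set
HasRank x r = SatChain 0̂ x r

private
  count-all : ∀ n → blockSize (replicate n (F.zero {0})) F.zero ≡ n
  count-all zero = refl
  count-all (suc n) = cong suc (count-all n)

  odd% : ∀ m → suc (2 * m) % 2 ≡ 1
  odd% m = subst (λ t → suc t % 2 ≡ 1) (*-comm m 2) ([m+kn]%n≡m%n 1 m 2)

1̂ : (m : ℕ) → Ω̆ 2 (suc (2 * m))
1̂ m = just (osp 1 (replicate (suc (2 * m)) F.zero) pf)
  where
  pf : T (validᵇ 2 (replicate (suc (2 * m)) F.zero))
  pf = subst (λ s → T (((1 ≤ᵇ s) ∧ ((s % 2) ≡ᵇ 1)) ∧ true))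
             (Relation.Binary.PropositionalEquality.sym (count-all (suc (2 * m))))
             (subst (λ t → T ((t ≡ᵇ 1) ∧ true))
                    (Relation.Binary.PropositionalEquality.sym (odd% m)) _)
    where import Relation.Binary.PropositionalEquality

Crk : (m : ℕ) → Ω̆ 2 (suc (2 * m)) → ℕ → Set
Crk m ω k = Σ ℕ λ r → Σ ℕ λ s → HasRank ω r × HasRank (1̂ m) s × (s ≡ r + k)

-- An ordered set partition of [n] with odd blocks is a map b : [n] → Fin k
-- with odd fibres, and ω ≤ ψ means ψ = g ∘ ω for a monotone g, whose fibres
-- are then odd as well.  Hence n = k + 2·excess, a cover merges three
-- consecutive blocks (if some fibre of g has three points, monotonicity puts
-- i and i+2 in it), and an atom has only singleton blocks, since a block of
-- size ≥ 3 splits into three.  So rk ω = 1 + excess ω, and an element above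
-- an atom has corank k exactly when it has 2k+1 blocks.  These elements are
-- the monotone maps Fin (2m+1) → Fin (2k+1) with odd fibres, i.e. the
-- compositions of 2m+1 into 2k+1 odd parts; splitting off a first part equal
-- to 1, or else shrinking it by 2, gives Pascal's rule and the count C(m+k, 2k).

module Submission where

open import Defs

open import Data.Bool using (Bool; T; if_then_else_)
open import Data.Bool.Properties using (T-∧; T-irrelevant)
open import Data.Empty using (⊥-elim)
open import Data.Fin using (Fin; zero; suc; toℕ) renaming (_≟_ to _≟F_)
import Data.Fin as F
open import Data.Fin.Induction using (<-wellFounded)
import Data.Fin.Properties as FP
open import Data.List using (List; []; _∷_; length; allFin)
import Data.List as L
open import Data.List.Membership.Propositional using (_∈_)
open import Data.List.Membership.Propositional.Properties
  using (∈-allFin; ∈-map⁺; ∈-map⁻; ∈-++⁺ˡ; ∈-++⁺ʳ; ∈-++⁻)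
open import Data.List.Properties using (length-map; length-++)
open import Data.List.Relation.Unary.All using ([])
import Data.List.Relation.Unary.All as All
open import Data.List.Relation.Unary.AllPairs using ([]; _∷_)
open import Data.List.Relation.Unary.Any using (here; there)
open import Data.List.Relation.Unary.Unique.Propositional using (Unique)
import Data.List.Relation.Unary.Unique.Propositional.Properties as UP
open import Data.Maybe using (just; nothing)
open import Data.Maybe.Properties using (just-injective)
open import Data.Nat
  using (ℕ; zero; suc; _+_; _*_; _∸_; _/_; _%_; _≤_; _<_; z≤n; s≤s; s≤s⁻¹; _≤ᵇ_; _≟_; _<?_; _≤?_)
open import Data.Nat.Combinatorics using (_C_; nCk+nC[k+1]≡[n+1]C[k+1]; k>n⇒nCk≡0)
open import Data.Nat.DivMod using ([m+kn]%n≡m%n; m≡m%n+[m/n]*n)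
open import Data.Nat.Properties
open import Algebra.Properties.Semiring.Sum +-*-semiring
  using (sum; sum-syntax; sum-cong-≗; ∑-distrib-+; ∑-comm; *-distribˡ-sum; sum-replicate-zero)
open import Data.Nat.Tactic.RingSolver using (solve-∀)
open import Data.Product using (Σ; ∃; ∃₂; _×_; _,_; proj₁; proj₂)
open import Data.Sum using (_⊎_; inj₁; inj₂)
open import Data.Vec using (Vec; []; _∷_; map; lookup; tabulate)
open import Data.Vec.Functional using (updateAt)
open import Data.Vec.Functional.Properties using (updateAt-updates; updateAt-minimal)
open import Data.Vec.Properties
  using (∷-injectiveˡ; ∷-injectiveʳ; lookup-map; lookup∘tabulate; tabulate∘lookup;
         map-cong; map-id; map-∘; tabulate-cong; tabulate-∘)
open import Function.Bundles using (Equivalence; _⇔_; mk⇔)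
open import Induction.WellFounded using (Acc; acc)
open import Relation.Binary.PropositionalEquality
  using (_≡_; _≢_; refl; sym; trans; cong; cong₂; subst; subst₂; module ≡-Reasoning)
open import Relation.Nullary using (¬_; yes; no; does)
open import Relation.Nullary.Decidable using (T?)

δ : ∀ {k} → Fin k → Fin k → ℕ
δ a b = if does (a ≟F b) then 1 else 0

δ-≡ : ∀ {k} {a b : Fin k} → a ≡ b → δ a b ≡ 1
δ-≡ {a = a} {b} a≡b with a ≟F b
... | yes _ = refl
... | no a≢b = ⊥-elim (a≢b a≡b)

δ-≢ : ∀ {k} {a b : Fin k} → a ≢ b → δ a b ≡ 0
δ-≢ {a = a} {b} a≢b with a ≟F b
... | yes a≡b = ⊥-elim (a≢b a≡b)
... | no _ = refl

δ-sym : ∀ {k} (a b : Fin k) → δ a b ≡ δ b a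
δ-sym a b with b ≟F a
... | yes refl = δ-≡ {a = a} refl
... | no b≢a = δ-≢ (λ a≡b → b≢a (sym a≡b))

δ-pos⇒≡ : ∀ {k} {a b : Fin k} → 0 < δ a b → a ≡ b
δ-pos⇒≡ {a = a} {b} pos with a ≟F b
... | yes a≡b = a≡b

δ≤1 : ∀ {k} (a b : Fin k) → δ a b ≤ 1
δ≤1 a b with a ≟F b
... | yes _ = ≤-refl
... | no _ = z≤n

∑-δ : ∀ {k} (f : Fin k → ℕ) (i : Fin k) → ∑[ a < k ] (f a * δ a i) ≡ f i
∑-δ {suc k} f zero = begin
  f zero * 1 + ∑[ a < k ] (f (suc a) * 0) ≡⟨ cong₂ _+_ (*-identityʳ (f zero)) (sum-cong-≗ (λ a → *-zeroʳ (f (suc a)))) ⟩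
  f zero + ∑[ a < k ] 0                 ≡⟨ cong (f zero +_) (sum-replicate-zero k) ⟩
  f zero + 0                            ≡⟨ +-identityʳ (f zero) ⟩
  f zero                                ∎
  where open ≡-Reasoning
∑-δ {suc k} f (suc i) =
  trans (cong (_+ ∑[ a < k ] (f (suc a) * δ a i)) (*-zeroʳ (f zero))) (∑-δ (λ a → f (suc a)) i)

∑-δ-1 : ∀ {k} (i : Fin k) → ∑[ a < k ] δ a i ≡ 1
∑-δ-1 i = trans (sum-cong-≗ (λ a → sym (*-identityˡ (δ a i)))) (∑-δ (λ _ → 1) i)

∑-1 : ∀ k → ∑[ a < k ] 1 ≡ k
∑-1 zero = refl
∑-1 (suc k) = cong suc (∑-1 k)

∑-mono-≤ : ∀ {k} {f g : Fin k → ℕ} → (∀ a → f a ≤ g a) → sum f ≤ sum g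
∑-mono-≤ {zero} f≤g = z≤n
∑-mono-≤ {suc k} f≤g = +-mono-≤ (f≤g zero) (∑-mono-≤ (λ a → f≤g (suc a)))

∑≡0⇒≡0 : ∀ {k} (f : Fin k → ℕ) → sum f ≡ 0 → ∀ a → f a ≡ 0
∑≡0⇒≡0 {suc k} f ∑≡0 zero = m+n≡0⇒m≡0 (f zero) ∑≡0
∑≡0⇒≡0 {suc k} f ∑≡0 (suc a) = ∑≡0⇒≡0 (λ b → f (suc b)) (m+n≡0⇒n≡0 (f zero) ∑≡0) a

∑>0⇒>0 : ∀ {k} (f : Fin k → ℕ) → 0 < sum f → ∃ λ a → 0 < f a
∑>0⇒>0 {suc k} f pos with f zero in eq
... | suc _ = zero , subst (0 <_) (sym eq) (s≤s z≤n)
... | zero with ∑>0⇒>0 (λ b → f (suc b)) pos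
...   | a , fa>0 = suc a , fa>0

fibre : ∀ {m k} → (Fin m → Fin k) → Fin k → ℕ
fibre {m} f j = ∑[ q < m ] δ (f q) j

fibre-total : ∀ {m k} (f : Fin m → Fin k) → ∑[ j < k ] fibre f j ≡ m
fibre-total {m} {k} f = begin
  ∑[ j < k ] ∑[ q < m ] δ (f q) j ≡⟨ ∑-comm (λ q j → δ (f q) j) ⟨
  ∑[ q < m ] ∑[ j < k ] δ (f q) j ≡⟨ sum-cong-≗ (λ q → trans (sum-cong-≗ (δ-sym (f q))) (∑-δ-1 (f q))) ⟩
  ∑[ q < m ] 1                    ≡⟨ ∑-1 m ⟩
  m                               ∎
  where open ≡-Reasoning

fibre-∘ : ∀ {m k l} (g : Fin k → Fin l) (f : Fin m → Fin k) j →
          fibre (λ q → g (f q)) j ≡ ∑[ a < k ] (δ (g a) j * fibre f a)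
fibre-∘ {m} {k} g f j = begin
  ∑[ q < m ] δ (g (f q)) j
    ≡⟨ sum-cong-≗ (λ q → ∑-δ (λ a → δ (g a) j) (f q)) ⟨
  ∑[ q < m ] ∑[ a < k ] (δ (g a) j * δ a (f q))
    ≡⟨ ∑-comm (λ q a → δ (g a) j * δ a (f q)) ⟩
  ∑[ a < k ] ∑[ q < m ] (δ (g a) j * δ a (f q))
    ≡⟨ sum-cong-≗ (λ a → *-distribˡ-sum (δ (g a) j) (λ q → δ a (f q))) ⟨
  ∑[ a < k ] (δ (g a) j * ∑[ q < m ] δ a (f q))
    ≡⟨ sum-cong-≗ (λ a → cong (δ (g a) j *_) (sum-cong-≗ (λ q → δ-sym a (f q)))) ⟩
  ∑[ a < k ] (δ (g a) j * fibre f a)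
    ∎
  where open ≡-Reasoning

fibre>0⇒∈image : ∀ {m k} (f : Fin m → Fin k) j → 0 < fibre f j → ∃ λ q → f q ≡ j
fibre>0⇒∈image f j pos with ∑>0⇒>0 (λ q → δ (f q) j) pos
... | q , δ>0 = q , δ-pos⇒≡ δ>0

blockSize≡fibre : ∀ {n k} (v : Vec (Fin k) n) j → blockSize v j ≡ fibre (lookup v) j
blockSize≡fibre [] j = refl
blockSize≡fibre (x ∷ v) j with x ≟F j
... | yes _ = cong suc (blockSize≡fibre v j)
... | no _ = blockSize≡fibre v j

Odd : ℕ → Set
Odd c = c % 2 ≡ 1

odd⇒≡1+2*half : ∀ {c} → Odd c → c ≡ suc (2 * (c / 2))
odd⇒≡1+2*half {c} odd = begin
  c                   ≡⟨ m≡m%n+[m/n]*n c 2 ⟩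
  c % 2 + c / 2 * 2   ≡⟨ cong₂ _+_ odd (*-comm (c / 2) 2) ⟩
  suc (2 * (c / 2))   ∎
  where open ≡-Reasoning

odd⇒>0 : ∀ {c} → Odd c → 0 < c
odd⇒>0 {suc c} _ = s≤s z≤n

[m+2n]%2≡m%2 : ∀ m n → (m + 2 * n) % 2 ≡ m % 2
[m+2n]%2≡m%2 m n = trans (cong (λ t → (m + t) % 2) (*-comm 2 n)) ([m+kn]%n≡m%n m n 2)

1+2m≢2n : ∀ m n → suc (2 * m) ≢ 2 * n
1+2m≢2n m n eq with trans (sym ([m+2n]%2≡m%2 1 m)) (trans (cong (_% 2) eq) ([m+2n]%2≡m%2 0 n))
... | ()

∑-odd : ∀ {k} (f : Fin k → ℕ) → (∀ a → Odd (f a)) → sum f ≡ k + 2 * ∑[ a < k ] (f a / 2)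
∑-odd {k} f odd = begin
  sum f                                         ≡⟨ sum-cong-≗ (λ a → odd⇒≡1+2*half (odd a)) ⟩
  ∑[ a < k ] (1 + 2 * (f a / 2))                ≡⟨ ∑-distrib-+ (λ _ → 1) (λ a → 2 * (f a / 2)) ⟩
  ∑[ a < k ] 1 + ∑[ a < k ] (2 * (f a / 2))     ≡⟨ cong₂ _+_ (∑-1 k) (sym (*-distribˡ-sum 2 (λ a → f a / 2))) ⟩
  k + 2 * ∑[ a < k ] (f a / 2)                  ∎
  where open ≡-Reasoning

OddFibres : ∀ {m k} → (Fin m → Fin k) → Set
OddFibres f = ∀ j → Odd (fibre f j)

fibre-cong : ∀ {m k} {f g : Fin m → Fin k} → (∀ q → f q ≡ g q) → ∀ j → fibre f j ≡ fibre g j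
fibre-cong f≗g j = sum-cong-≗ (λ q → cong (λ a → δ a j) (f≗g q))

T-allᵇ⁻ : ∀ {A : Set} {p : A → Bool} {xs : List A} {x} → T (allᵇ p xs) → x ∈ xs → T (p x)
T-allᵇ⁻ {p = p} {y ∷ _} all (here refl) = proj₁ (Equivalence.to (T-∧ {p y}) all)
T-allᵇ⁻ {p = p} {y ∷ _} all (there x∈xs) = T-allᵇ⁻ (proj₂ (Equivalence.to (T-∧ {p y}) all)) x∈xs

T-allᵇ⁺ : ∀ {A : Set} {p : A → Bool} (xs : List A) → (∀ x → T (p x)) → T (allᵇ p xs)
T-allᵇ⁺ [] _ = _
T-allᵇ⁺ (y ∷ ys) all = Equivalence.from T-∧ (all y , T-allᵇ⁺ ys all)

valid⇒oddFibres : ∀ {n k} (v : Vec (Fin k) n) → T (validᵇ 2 v) → OddFibres (lookup v)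
valid⇒oddFibres {k = k} v valid j = subst Odd (blockSize≡fibre v j) (≡ᵇ⇒≡ _ 1 odd)
  where odd = proj₂ (Equivalence.to T-∧ (T-allᵇ⁻ {xs = allFin k} valid (∈-allFin j)))

oddFibres⇒valid : ∀ {n k} (v : Vec (Fin k) n) → OddFibres (lookup v) → T (validᵇ 2 v)
oddFibres⇒valid {k = k} v odd = T-allᵇ⁺ (allFin k) (λ j → Equivalence.from T-∧ (nonempty j , ≡⇒≡ᵇ _ 1 (odd′ j)))
  where
  odd′ : ∀ j → Odd (blockSize v j)
  odd′ j = subst Odd (sym (blockSize≡fibre v j)) (odd j)
  nonempty : ∀ j → T (1 ≤ᵇ blockSize v j)
  nonempty j = ≤⇒≤ᵇ (odd⇒>0 {blockSize v j} (odd′ j))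

tabulate-valid : ∀ {n k} (f : Fin n → Fin k) → OddFibres f → T (validᵇ 2 (tabulate f))
tabulate-valid f odd = oddFibres⇒valid (tabulate f) λ j → subst Odd (fibre-cong (λ q → sym (lookup∘tabulate f q)) j) (odd j)

osp-≡ : ∀ {n k} {b b′ : Vec (Fin k) n} {p : T (validᵇ 2 b)} {p′ : T (validᵇ 2 b′)} →
        b ≡ b′ → osp k b p ≡ osp k b′ p′
osp-≡ {b = b} {p = p} {p′} refl = cong (osp _ b) (T-irrelevant p p′)

osp-injective : ∀ {n k} {b b′ : Vec (Fin k) n} {p : T (validᵇ 2 b)} {p′ : T (validᵇ 2 b′)} →
                osp k b p ≡ osp k b′ p′ → b ≡ b′
osp-injective refl = refl

blocks-odd : ∀ {n} (x : OSP 2 n) → OddFibres (lookup (blocks x))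
blocks-odd x = valid⇒oddFibres (blocks x) (valid x)

oddFibres-count : ∀ {m l} (g : Fin m → Fin l) → OddFibres g → m ≡ l + 2 * ∑[ j < l ] (fibre g j / 2)
oddFibres-count g odd = trans (sym (fibre-total g)) (∑-odd (fibre g) odd)

-- rank x = 1 + excess x, see rank≡1+excess.
excess : ∀ {n} → OSP 2 n → ℕ
excess x = ∑[ i < nblocks x ] (fibre (lookup (blocks x)) i / 2)

n≡nblocks+2*excess : ∀ {n} (x : OSP 2 n) → n ≡ nblocks x + 2 * excess x
n≡nblocks+2*excess x = oddFibres-count (lookup (blocks x)) (blocks-odd x)

fibre-∘-parity : ∀ {m k l} (g : Fin k → Fin l) (f : Fin m → Fin k) → OddFibres f → ∀ j →
                 fibre (λ q → g (f q)) j % 2 ≡ fibre g j % 2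
fibre-∘-parity {k = k} g f odd j = begin
  fibre (λ q → g (f q)) j % 2  ≡⟨ cong (_% 2) fibre-∘≡ ⟩
  (fibre g j + 2 * S) % 2      ≡⟨ [m+2n]%2≡m%2 (fibre g j) S ⟩
  fibre g j % 2                ∎
  where
  open ≡-Reasoning
  h : Fin k → ℕ
  h a = fibre f a / 2
  S : ℕ
  S = ∑[ a < k ] (δ (g a) j * h a)
  distrib : ∀ x y → x * (1 + 2 * y) ≡ x + 2 * (x * y)
  distrib = solve-∀
  fibre-∘≡ : fibre (λ q → g (f q)) j ≡ fibre g j + 2 * S
  fibre-∘≡ = begin
    fibre (λ q → g (f q)) j
      ≡⟨ fibre-∘ g f j ⟩
    ∑[ a < k ] (δ (g a) j * fibre f a)
      ≡⟨ sum-cong-≗ (λ a → trans (cong (δ (g a) j *_) (odd⇒≡1+2*half (odd a))) (distrib (δ (g a) j) (h a))) ⟩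
    ∑[ a < k ] (δ (g a) j + 2 * (δ (g a) j * h a))
      ≡⟨ ∑-distrib-+ (λ a → δ (g a) j) (λ a → 2 * (δ (g a) j * h a)) ⟩
    fibre g j + ∑[ a < k ] (2 * (δ (g a) j * h a))
      ≡⟨ cong (fibre g j +_) (*-distribˡ-sum 2 (λ a → δ (g a) j * h a)) ⟨
    fibre g j + 2 * S
      ∎

∘-oddFibres : ∀ {m k l} (g : Fin k → Fin l) (f : Fin m → Fin k) →
              OddFibres f → OddFibres g → OddFibres (λ q → g (f q))
∘-oddFibres g f oddf oddg j = trans (fibre-∘-parity g f oddf j) (oddg j)

oddFibres-∘⁻ : ∀ {m k l} (g : Fin k → Fin l) (f : Fin m → Fin k) →
               OddFibres f → OddFibres (λ q → g (f q)) → OddFibres g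
oddFibres-∘⁻ g f oddf oddgf j = trans (sym (fibre-∘-parity g f oddf j)) (oddgf j)

Monotone : ∀ {k l} → (Fin k → Fin l) → Set
Monotone g = ∀ i j → i F.≤ j → g i F.≤ g j

≤-oddFibres : ∀ {n} {x y : OSP 2 n} ((g , _ , _) : x ≤O y) → OddFibres g
≤-oddFibres {x = x} {y} (g , _ , y≡gx) = oddFibres-∘⁻ g (lookup (blocks x)) (blocks-odd x) odd-gx
  where
  odd-gx : OddFibres (λ q → g (lookup (blocks x) q))
  odd-gx j = subst Odd (fibre-cong (λ q → trans (cong (λ v → lookup v q) y≡gx) (lookup-map q g (blocks x))) j)
                   (blocks-odd y j)

≤-nblocks : ∀ {n} {x y : OSP 2 n} ((g , _ , _) : x ≤O y) →
            nblocks x ≡ nblocks y + 2 * ∑[ j < nblocks y ] (fibre g j / 2)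
≤-nblocks {x = x} {y} x≤y@(g , _ , _) = oddFibres-count g (≤-oddFibres {x = x} {y} x≤y)

≤⇒nblocks-≥ : ∀ {n} {x y : OSP 2 n} → x ≤O y → nblocks y ≤ nblocks x
≤⇒nblocks-≥ {x = x} {y} x≤y = subst (nblocks y ≤_) (sym (≤-nblocks {x = x} {y} x≤y)) (m≤m+n _ _)

fibre≥2 : ∀ {m k} (f : Fin m → Fin k) {a b} → a ≢ b → f a ≡ f b → 2 ≤ fibre f (f b)
fibre≥2 {m} f {a} {b} a≢b fa≡fb = begin
  2                                  ≡⟨ cong₂ _+_ (∑-δ-1 a) (∑-δ-1 b) ⟨
  ∑[ c < m ] δ c a + ∑[ c < m ] δ c b ≡⟨ ∑-distrib-+ (λ c → δ c a) (λ c → δ c b) ⟨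
  ∑[ c < m ] (δ c a + δ c b)          ≤⟨ ∑-mono-≤ pointwise ⟩
  fibre f (f b)                      ∎
  where
  open ≤-Reasoning
  pointwise : ∀ c → δ c a + δ c b ≤ δ (f c) (f b)
  pointwise c with c ≟F a | c ≟F b
  ... | yes refl | yes refl = ⊥-elim (a≢b refl)
  ... | yes refl | no _ = ≤-reflexive (trans (+-identityʳ 1) (sym (δ-≡ fa≡fb)))
  ... | no _ | yes refl = ≤-reflexive (sym (δ-≡ {a = f c} refl))
  ... | no _ | no _ = z≤n

module _ {k} (g : Fin k → Fin k) (mono : Monotone g)
         (inj : ∀ {a b} → g a ≡ g b → a ≡ b) (surj : ∀ j → ∃ λ a → g a ≡ j) where

  monotone-bijection≗id : ∀ i → g i ≡ i
  monotone-bijection≗id i = go i (<-wellFounded i)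
    where
    go : ∀ i → Acc F._<_ i → g i ≡ i
    go i (acc below) = FP.toℕ-injective (≤-antisym gi≤i i≤gi)
      where
      ih : ∀ {j} → j F.< i → g j ≡ j
      ih j<i = go _ (below j<i)
      gi≤i : g i F.≤ i
      gi≤i with surj i
      ... | a , ga≡i with toℕ a <? toℕ i
      ...   | yes a<i = ⊥-elim (<-irrefl (cong toℕ (trans (sym (ih a<i)) ga≡i)) a<i)
      ...   | no a≮i = subst (λ c → g i F.≤ c) ga≡i (mono i a (≮⇒≥ a≮i))
      i≤gi : i F.≤ g i
      i≤gi with toℕ (g i) <? toℕ i
      ... | yes gi<i = ⊥-elim (<-irrefl (cong toℕ (inj (ih gi<i))) gi<i)
      ... | no gi≮i = ≮⇒≥ gi≮i

-- All fibres of g then have one point, so g is a monotone bijection, the identity.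
≤∧nblocks≡⇒≡ : ∀ {n} {x y : OSP 2 n} → x ≤O y → nblocks x ≡ nblocks y → x ≡ y
≤∧nblocks≡⇒≡ {x = osp k b p} {osp .k b′ p′} x≤y@(g , mono , b′≡gb) refl =
  osp-≡ (sym (trans b′≡gb (trans (map-cong g≗id b) (map-id b))))
  where
  ∑half≡0 : ∑[ j < k ] (fibre g j / 2) ≡ 0
  ∑half≡0 = *-cancelˡ-≡ _ 0 2 (+-cancelˡ-≡ k _ _
              (trans (sym (≤-nblocks {x = osp k b p} {osp k b′ p′} x≤y)) (sym (+-identityʳ k))))
  fibre≡1 : ∀ j → fibre g j ≡ 1
  fibre≡1 j = trans (odd⇒≡1+2*half (≤-oddFibres {x = osp k b p} {osp k b′ p′} x≤y j))
                    (cong (λ h → suc (2 * h)) (∑≡0⇒≡0 _ ∑half≡0 j))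
  inj : ∀ {a c} → g a ≡ g c → a ≡ c
  inj {a} {c} ga≡gc with a ≟F c
  ... | yes a≡c = a≡c
  ... | no a≢c = ⊥-elim (<-irrefl refl (subst (2 ≤_) (fibre≡1 (g c)) (fibre≥2 g a≢c ga≡gc)))
  g≗id : ∀ i → g i ≡ i
  g≗id = monotone-bijection≗id g mono inj (λ j → fibre>0⇒∈image g j (subst (0 <_) (sym (fibre≡1 j)) (s≤s z≤n)))

≤∧≢⇒nblocks-< : ∀ {n} {x y : OSP 2 n} → x ≤O y → x ≢ y → nblocks y < nblocks x
≤∧≢⇒nblocks-< {x = x} {y} x≤y x≢y =
  ≤∧≢⇒< (≤⇒nblocks-≥ {x = x} {y} x≤y) (λ eq → x≢y (≤∧nblocks≡⇒≡ {x = x} {y} x≤y (sym eq)))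

fibre-beyond : ∀ {m k} (f : Fin m → Fin k) j r → r < fibre f j → ∃ λ q → f q ≡ j × r ≤ toℕ q
fibre-beyond f j zero pos = let q , fq≡j = fibre>0⇒∈image f j pos in q , fq≡j , z≤n
fibre-beyond {suc m} f j (suc r) r<fibre with fibre-beyond (λ q → f (suc q)) j r r<fibre′
  where
  r<fibre′ : r < fibre (λ q → f (suc q)) j
  r<fibre′ = +-cancelˡ-< 1 r _ (<-≤-trans r<fibre (+-monoˡ-≤ _ (δ≤1 (f zero) j)))
... | q , fq≡j , r≤q = suc q , fq≡j , s≤s r≤q

fibre≥3⇒spread : ∀ {m k} (f : Fin m → Fin k) j → 3 ≤ fibre f j →
                 ∃₂ λ u w → f u ≡ j × f w ≡ j × 2 + toℕ u ≤ toℕ w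
fibre≥3⇒spread {suc m} f j three≤ with f zero ≟F j
... | yes f0≡j = let q , fq≡j , 1≤q = fibre-beyond (λ q → f (suc q)) j 1 (s≤s⁻¹ three≤)
                 in zero , suc q , f0≡j , fq≡j , s≤s 1≤q
... | no _ = let u , w , fu≡j , fw≡j , u+2≤w = fibre≥3⇒spread (λ q → f (suc q)) j three≤
             in suc u , suc w , fu≡j , fw≡j , s≤s u+2≤w

odd∧∑half>0⇒≥3 : ∀ {k} (f : Fin k → ℕ) → (∀ a → Odd (f a)) → 0 < ∑[ a < k ] (f a / 2) → ∃ λ a → 3 ≤ f a
odd∧∑half>0⇒≥3 f odd pos with ∑>0⇒>0 (λ a → f a / 2) pos
... | a , half>0 = a , subst (3 ≤_) (sym (odd⇒≡1+2*half (odd a))) (s≤s (*-monoʳ-≤ 2 half>0))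

-- Merging three consecutive blocks

-- pinch₃ i merges left₃ i, mid₃ i, right₃ i (that is, i, i+1, i+2) into i,
-- like a threefold Data.Fin.pinch.
left₃ mid₃ right₃ : ∀ {k} → Fin k → Fin (2 + k)
left₃ zero = zero
left₃ (suc i) = suc (left₃ i)
mid₃ zero = suc zero
mid₃ (suc i) = suc (mid₃ i)
right₃ zero = suc (suc zero)
right₃ (suc i) = suc (right₃ i)

toℕ-left₃ : ∀ {k} (i : Fin k) → toℕ (left₃ i) ≡ toℕ i
toℕ-left₃ zero = refl
toℕ-left₃ (suc i) = cong suc (toℕ-left₃ i)

toℕ-mid₃ : ∀ {k} (i : Fin k) → toℕ (mid₃ i) ≡ 1 + toℕ i
toℕ-mid₃ zero = refl
toℕ-mid₃ (suc i) = cong suc (toℕ-mid₃ i)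

toℕ-right₃ : ∀ {k} (i : Fin k) → toℕ (right₃ i) ≡ 2 + toℕ i
toℕ-right₃ zero = refl
toℕ-right₃ (suc i) = cong suc (toℕ-right₃ i)

pinch₃ : ∀ {k} → Fin k → Fin (2 + k) → Fin k
pinch₃ zero zero = zero
pinch₃ zero (suc zero) = zero
pinch₃ zero (suc (suc zero)) = zero
pinch₃ zero (suc (suc (suc a))) = suc a
pinch₃ (suc i) zero = zero
pinch₃ (suc i) (suc a) = suc (pinch₃ i a)

unpinch₃ : ∀ {k} → Fin k → Fin k → Fin (2 + k)
unpinch₃ zero zero = zero
unpinch₃ zero (suc a) = suc (suc (suc a))
unpinch₃ (suc i) zero = zero
unpinch₃ (suc i) (suc a) = suc (unpinch₃ i a)

pinch₃-mono : ∀ {k} (i : Fin k) → Monotone (pinch₃ i)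
pinch₃-mono zero a c a≤c = subst₂ _≤_ (sym (toℕ-pinch₃-zero a)) (sym (toℕ-pinch₃-zero c)) (∸-monoˡ-≤ 2 a≤c)
  where
  toℕ-pinch₃-zero : ∀ {k} (a : Fin (3 + k)) → toℕ (pinch₃ zero a) ≡ toℕ a ∸ 2
  toℕ-pinch₃-zero zero = refl
  toℕ-pinch₃-zero (suc zero) = refl
  toℕ-pinch₃-zero (suc (suc zero)) = refl
  toℕ-pinch₃-zero (suc (suc (suc a))) = refl
pinch₃-mono (suc i) zero c _ = z≤n
pinch₃-mono (suc i) (suc a) (suc c) (s≤s a≤c) = s≤s (pinch₃-mono i a c a≤c)

unpinch₃-mono : ∀ {k} (i : Fin k) → Monotone (unpinch₃ i)
unpinch₃-mono zero zero c _ = z≤n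
unpinch₃-mono zero (suc a) (suc c) (s≤s a≤c) = s≤s (s≤s (s≤s a≤c))
unpinch₃-mono (suc i) zero c _ = z≤n
unpinch₃-mono (suc i) (suc a) (suc c) (s≤s a≤c) = s≤s (unpinch₃-mono i a c a≤c)

pinch₃-unpinch₃ : ∀ {k} (i a : Fin k) → pinch₃ i (unpinch₃ i a) ≡ a
pinch₃-unpinch₃ zero zero = refl
pinch₃-unpinch₃ zero (suc a) = refl
pinch₃-unpinch₃ (suc i) zero = refl
pinch₃-unpinch₃ (suc i) (suc a) = cong suc (pinch₃-unpinch₃ i a)

unpinch₃-self : ∀ {k} (i : Fin k) → unpinch₃ i i ≡ left₃ i
unpinch₃-self zero = refl
unpinch₃-self (suc i) = cong suc (unpinch₃-self i)

pinch₃-mid₃ : ∀ {k} (i : Fin k) → pinch₃ i (mid₃ i) ≡ i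
pinch₃-mid₃ zero = refl
pinch₃-mid₃ (suc i) = cong suc (pinch₃-mid₃ i)

pinch₃-right₃ : ∀ {k} (i : Fin k) → pinch₃ i (right₃ i) ≡ i
pinch₃-right₃ zero = refl
pinch₃-right₃ (suc i) = cong suc (pinch₃-right₃ i)

unpinch₃-pinch₃ : ∀ {k} (i : Fin k) c → unpinch₃ i (pinch₃ i c) ≡ c ⊎ c ≡ mid₃ i ⊎ c ≡ right₃ i
unpinch₃-pinch₃ zero zero = inj₁ refl
unpinch₃-pinch₃ zero (suc zero) = inj₂ (inj₁ refl)
unpinch₃-pinch₃ zero (suc (suc zero)) = inj₂ (inj₂ refl)
unpinch₃-pinch₃ zero (suc (suc (suc a))) = inj₁ refl
unpinch₃-pinch₃ (suc i) zero = inj₁ refl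
unpinch₃-pinch₃ (suc i) (suc c) with unpinch₃-pinch₃ i c
... | inj₁ eq = inj₁ (cong suc eq)
... | inj₂ (inj₁ eq) = inj₂ (inj₁ (cong suc eq))
... | inj₂ (inj₂ eq) = inj₂ (inj₂ (cong suc eq))

pinch₃-oddFibres : ∀ {k} (i : Fin k) → OddFibres (pinch₃ i)
pinch₃-oddFibres {suc k} zero zero = cong (λ s → (3 + s) % 2) (sum-replicate-zero k)
pinch₃-oddFibres {suc k} zero (suc j) = cong (_% 2) (∑-δ-1 j)
pinch₃-oddFibres {suc k} (suc i) zero = cong (λ s → (1 + s) % 2) (sum-replicate-zero (2 + k))
pinch₃-oddFibres {suc k} (suc i) (suc j) = pinch₃-oddFibres i j

monotone-squeeze : ∀ {k l} {g : Fin k → Fin l} → Monotone g →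
                   ∀ {a b c} → toℕ a ≤ toℕ b → toℕ b ≤ toℕ c → g a ≡ g c → g b ≡ g a
monotone-squeeze {g = g} mono {a} {b} {c} a≤b b≤c ga≡gc =
  FP.toℕ-injective (≤-antisym (subst (λ d → g b F.≤ d) (sym ga≡gc) (mono b c b≤c)) (mono a b a≤b))

monotone-collapse : ∀ {k l} (g : Fin (2 + k) → Fin l) → Monotone g → ∀ {u w} → g u ≡ g w → 2 + toℕ u ≤ toℕ w →
                    ∃ λ i → g (left₃ i) ≡ g (right₃ i)
monotone-collapse {k} g mono {u} {w} gu≡gw u+2≤w = i , trans (cong g left≡u) (sym gr≡gu)
  where
  u<k : toℕ u < k
  u<k = s≤s⁻¹ (s≤s⁻¹ (≤-trans (s≤s u+2≤w) (FP.toℕ<n w)))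
  i : Fin k
  i = F.fromℕ< u<k
  left≡u : left₃ i ≡ u
  left≡u = FP.toℕ-injective (trans (toℕ-left₃ i) (FP.toℕ-fromℕ< u<k))
  toℕ-right : toℕ (right₃ i) ≡ 2 + toℕ u
  toℕ-right = trans (toℕ-right₃ i) (cong (2 +_) (FP.toℕ-fromℕ< u<k))
  gr≡gu : g (right₃ i) ≡ g u
  gr≡gu = monotone-squeeze mono (subst (toℕ u ≤_) (sym toℕ-right) (m≤n+m _ 2))
                                (subst (_≤ toℕ w) (sym toℕ-right) u+2≤w) gu≡gw

-- Fewer values than points forces a fibre with three points, hence (spread) two at distance ≥ 2.
monotone-oddFibres-collapse : ∀ {k l} (g : Fin (2 + k) → Fin l) → Monotone g → OddFibres g → l < 2 + k →
                              ∃ λ i → g (left₃ i) ≡ g (right₃ i)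
monotone-oddFibres-collapse {k} {l} g mono odd l<2+k
  with odd∧∑half>0⇒≥3 (fibre g) odd ∑half>0
  where
  ∑half>0 : 0 < ∑[ j < l ] (fibre g j / 2)
  ∑half>0 = n≢0⇒n>0 λ ∑half≡0 →
    <-irrefl (sym (trans (oddFibres-count g odd) (trans (cong (λ s → l + 2 * s) ∑half≡0) (+-identityʳ l)))) l<2+k
... | j , three≤ with fibre≥3⇒spread g j three≤
...   | u , w , gu≡j , gw≡j , u+2≤w = monotone-collapse g mono (trans gu≡j (sym gw≡j)) u+2≤w

collapse-factor : ∀ {k l} (g : Fin (2 + k) → Fin l) → Monotone g → ∀ {i} → g (left₃ i) ≡ g (right₃ i) →
                  ∀ c → g (unpinch₃ i (pinch₃ i c)) ≡ g c
collapse-factor g mono {i} gl≡gr c with unpinch₃-pinch₃ i c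
... | inj₁ eq = cong g eq
... | inj₂ (inj₁ refl) = trans (cong g (trans (cong (unpinch₃ i) (pinch₃-mid₃ i)) (unpinch₃-self i)))
                               (sym (monotone-squeeze mono left≤mid mid≤right gl≡gr))
  where
  left≤mid : toℕ (left₃ i) ≤ toℕ (mid₃ i)
  left≤mid = subst₂ _≤_ (sym (toℕ-left₃ i)) (sym (toℕ-mid₃ i)) (n≤1+n _)
  mid≤right : toℕ (mid₃ i) ≤ toℕ (right₃ i)
  mid≤right = subst₂ _≤_ (sym (toℕ-mid₃ i)) (sym (toℕ-right₃ i)) (n≤1+n _)
... | inj₂ (inj₂ refl) = trans (cong g (trans (cong (unpinch₃ i) (pinch₃-right₃ i)) (unpinch₃-self i))) gl≡gr

map-valid : ∀ {n k l} {g : Fin k → Fin l} (b : Vec (Fin k) n) → OddFibres g → T (validᵇ 2 b) → T (validᵇ 2 (map g b))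
map-valid {g = g} b oddg valid = oddFibres⇒valid (map g b) λ j →
  subst Odd (fibre-cong (λ q → sym (lookup-map q g b)) j) (∘-oddFibres g (lookup b) (valid⇒oddFibres b valid) oddg j)

merge₃ : ∀ {n k} (b : Vec (Fin (2 + k)) n) → T (validᵇ 2 b) → Fin k → OSP 2 n
merge₃ b valid i = osp _ (map (pinch₃ i) b) (map-valid b (pinch₃-oddFibres i) valid)

merge-between : ∀ {n} {x y : OSP 2 n} → x ≤O y → nblocks y < nblocks x →
                ∃ λ z → x ≤O z × z ≤O y × nblocks x ≡ 2 + nblocks z
merge-between {x = osp (suc zero) b valid} {osp zero b′ valid′} x≤y _ =
  ⊥-elim (1+n≢0 (≤-nblocks {x = osp 1 b valid} {osp 0 b′ valid′} x≤y))
merge-between {x = osp (suc zero) _ _} {osp (suc _) _ _} _ (s≤s ())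
merge-between {x = x@(osp (suc (suc k)) b valid)} {y@(osp l b′ valid′)} x≤y@(g , mono , b′≡gb) l<2+k =
  merge₃ b valid i , (pinch₃ i , pinch₃-mono i , refl) , (h , h-mono , b′≡hz) , refl
  where
  collapse : ∃ λ i → g (left₃ i) ≡ g (right₃ i)
  collapse = monotone-oddFibres-collapse g mono (≤-oddFibres {x = x} {y} x≤y) l<2+k
  i : Fin k
  i = proj₁ collapse
  h : Fin k → Fin l
  h a = g (unpinch₃ i a)
  h-mono : Monotone h
  h-mono a c a≤c = mono _ _ (unpinch₃-mono i a c a≤c)
  b′≡hz : b′ ≡ map h (map (pinch₃ i) b)
  b′≡hz = trans b′≡gb (trans (map-cong (λ c → sym (collapse-factor g mono (proj₂ collapse) c)) b) (map-∘ h (pinch₃ i) b))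

-- Splitting a block

fibre-updateAt : ∀ {m k} (f : Fin m → Fin k) p c j →
                 fibre (updateAt f p (λ _ → c)) j + δ (f p) j ≡ fibre f j + δ c j
fibre-updateAt {suc m} f zero c j = swap (δ c j) (fibre (λ q → f (suc q)) j) (δ (f zero) j)
  where
  swap : ∀ x y z → x + y + z ≡ z + y + x
  swap = solve-∀
fibre-updateAt {suc m} {k} f (suc p) c j = begin
  δ (f zero) j + fibre f′ j + δ (f (suc p)) j         ≡⟨ +-assoc (δ (f zero) j) _ _ ⟩
  δ (f zero) j + (fibre f′ j + δ (f (suc p)) j)       ≡⟨ cong (δ (f zero) j +_) (fibre-updateAt (λ q → f (suc q)) p c j) ⟩
  δ (f zero) j + (fibre (λ q → f (suc q)) j + δ c j)  ≡⟨ +-assoc (δ (f zero) j) _ _ ⟨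
  fibre f j + δ c j                                   ∎
  where
  open ≡-Reasoning
  f′ : Fin m → Fin k
  f′ = updateAt (λ q → f (suc q)) p (λ _ → c)

fibre-∘-injective : ∀ {m k l} (h : Fin k → Fin l) → (∀ {a b} → h a ≡ h b → a ≡ b) →
                    (f : Fin m → Fin k) → ∀ a → fibre (λ q → h (f q)) (h a) ≡ fibre f a
fibre-∘-injective h inj f a = sum-cong-≗ δ-h
  where
  δ-h : ∀ q → δ (h (f q)) (h a) ≡ δ (f q) a
  δ-h q with f q ≟F a
  ... | yes refl = δ-≡ {a = h (f q)} refl
  ... | no fq≢a = δ-≢ (λ eq → fq≢a (inj eq))

fibre-∉image : ∀ {m k} (f : Fin m → Fin k) j → (∀ q → f q ≢ j) → fibre f j ≡ 0
fibre-∉image {m} f j ∉image = trans (sum-cong-≗ (λ q → δ-≢ (∉image q))) (sum-replicate-zero m)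

left₃≢mid₃ : ∀ {k} (i : Fin k) → left₃ i ≢ mid₃ i
left₃≢mid₃ i eq = m≢1+n+m (toℕ i) {0} (trans (sym (toℕ-left₃ i)) (trans (cong toℕ eq) (toℕ-mid₃ i)))

left₃≢right₃ : ∀ {k} (i : Fin k) → left₃ i ≢ right₃ i
left₃≢right₃ i eq = m≢1+n+m (toℕ i) {1} (trans (sym (toℕ-left₃ i)) (trans (cong toℕ eq) (toℕ-right₃ i)))

mid₃≢right₃ : ∀ {k} (i : Fin k) → mid₃ i ≢ right₃ i
mid₃≢right₃ i eq = m≢1+n+m (toℕ i) {0} (suc-injective (trans (sym (toℕ-mid₃ i)) (trans (cong toℕ eq) (toℕ-right₃ i))))

unpinch₃-injective : ∀ {k} (i : Fin k) {a c} → unpinch₃ i a ≡ unpinch₃ i c → a ≡ c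
unpinch₃-injective i {a} {c} eq = trans (sym (pinch₃-unpinch₃ i a)) (trans (cong (pinch₃ i) eq) (pinch₃-unpinch₃ i c))

unpinch₃-avoids : ∀ {k} (i : Fin k) {a c} → pinch₃ i c ≡ i → c ≢ left₃ i → unpinch₃ i a ≢ c
unpinch₃-avoids i {a} pc≡i c≢left refl = c≢left (trans (cong (unpinch₃ i) a≡i) (unpinch₃-self i))
  where
  a≡i : a ≡ i
  a≡i = trans (sym (pinch₃-unpinch₃ i a)) pc≡i

-- Moves u and w out of block i into new singleton blocks mid₃ i and right₃ i;
-- block i itself becomes left₃ i, so pinch₃ i undoes the split.
module Split {n k} (b : Vec (Fin k) n) (i : Fin k) {u w : Fin n}
             (u≢w : u ≢ w) (bu≡i : lookup b u ≡ i) (bw≡i : lookup b w ≡ i) where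

  split₀ split₁ split : Fin n → Fin (2 + k)
  split₀ q = unpinch₃ i (lookup b q)
  split₁ = updateAt split₀ u (λ _ → mid₃ i)
  split = updateAt split₁ w (λ _ → right₃ i)

  split₀≡left₃ : ∀ {q} → lookup b q ≡ i → split₀ q ≡ left₃ i
  split₀≡left₃ bq≡i = trans (cong (unpinch₃ i) bq≡i) (unpinch₃-self i)

  pinch₃-split : ∀ q → pinch₃ i (split q) ≡ lookup b q
  pinch₃-split q with q ≟F w | q ≟F u
  ... | yes refl | _ = trans (cong (pinch₃ i) (updateAt-updates w split₁)) (trans (pinch₃-right₃ i) (sym bw≡i))
  ... | no q≢w | yes refl = trans (cong (pinch₃ i) (trans (updateAt-minimal q w split₁ q≢w) (updateAt-updates u split₀)))
                                  (trans (pinch₃-mid₃ i) (sym bu≡i))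
  ... | no q≢w | no q≢u =
    trans (cong (pinch₃ i) (trans (updateAt-minimal q w split₁ q≢w) (updateAt-minimal q u split₀ q≢u)))
          (pinch₃-unpinch₃ i (lookup b q))

  fibre-split : ∀ c → fibre split c + 2 * δ (left₃ i) c ≡ fibre split₀ c + (δ (mid₃ i) c + δ (right₃ i) c)
  fibre-split c = begin
    fibre split c + 2 * L                   ≡⟨ rearrange₁ (fibre split c) L ⟩
    (fibre split c + L) + L                 ≡⟨ cong (λ a → fibre split c + δ a c + L) split₁w≡left ⟨
    (fibre split c + δ (split₁ w) c) + L    ≡⟨ cong (_+ L) (fibre-updateAt split₁ w (right₃ i) c) ⟩
    (fibre split₁ c + R) + L                ≡⟨ rearrange₂ (fibre split₁ c) R L ⟩
    (fibre split₁ c + L) + R                ≡⟨ cong (λ a → fibre split₁ c + δ a c + R) (split₀≡left₃ bu≡i) ⟨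
    (fibre split₁ c + δ (split₀ u) c) + R   ≡⟨ cong (_+ R) (fibre-updateAt split₀ u (mid₃ i) c) ⟩
    (fibre split₀ c + M) + R                ≡⟨ +-assoc (fibre split₀ c) M R ⟩
    fibre split₀ c + (M + R)                ∎
    where
    open ≡-Reasoning
    L = δ (left₃ i) c
    M = δ (mid₃ i) c
    R = δ (right₃ i) c
    split₁w≡left : split₁ w ≡ left₃ i
    split₁w≡left = trans (updateAt-minimal w u split₀ (λ w≡u → u≢w (sym w≡u))) (split₀≡left₃ bw≡i)
    rearrange₁ : ∀ x y → x + 2 * y ≡ (x + y) + y
    rearrange₁ = solve-∀
    rearrange₂ : ∀ x y z → (x + y) + z ≡ (x + z) + y
    rearrange₂ = solve-∀

  fibre-split-new : ∀ {c} → pinch₃ i c ≡ i → left₃ i ≢ c → δ (mid₃ i) c + δ (right₃ i) c ≡ 1 →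
                    fibre split c ≡ 1
  fibre-split-new {c} pc≡i left≢c δs≡1 = begin
    fibre split c                                       ≡⟨ +-identityʳ _ ⟨
    fibre split c + 2 * 0                               ≡⟨ cong (λ d → fibre split c + 2 * d) (δ-≢ left≢c) ⟨
    fibre split c + 2 * δ (left₃ i) c                   ≡⟨ fibre-split c ⟩
    fibre split₀ c + (δ (mid₃ i) c + δ (right₃ i) c)    ≡⟨ cong₂ _+_ split₀-misses δs≡1 ⟩
    0 + 1                                               ∎
    where
    open ≡-Reasoning
    split₀-misses : fibre split₀ c ≡ 0
    split₀-misses = fibre-∉image split₀ c (λ q → unpinch₃-avoids i pc≡i (λ eq → left≢c (sym eq)))

  split-oddFibres : OddFibres (lookup b) → OddFibres split
  split-oddFibres odd c with unpinch₃-pinch₃ i c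
  ... | inj₁ c≡ι = begin
    fibre split c % 2                                   ≡⟨ [m+2n]%2≡m%2 (fibre split c) (δ (left₃ i) c) ⟨
    (fibre split c + 2 * δ (left₃ i) c) % 2             ≡⟨ cong (_% 2) (fibre-split c) ⟩
    (fibre split₀ c + (δ (mid₃ i) c + δ (right₃ i) c)) % 2
      ≡⟨ cong (λ s → (fibre split₀ c + s) % 2) (cong₂ _+_ (δ-≢ mid≢c) (δ-≢ right≢c)) ⟩
    (fibre split₀ c + 0) % 2                            ≡⟨ cong (_% 2) (+-identityʳ (fibre split₀ c)) ⟩
    fibre split₀ c % 2                                  ≡⟨ cong (_% 2) split₀-fibre ⟩
    fibre (lookup b) (pinch₃ i c) % 2                   ≡⟨ odd (pinch₃ i c) ⟩
    1                                                   ∎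
    where
    open ≡-Reasoning
    split₀-fibre : fibre split₀ c ≡ fibre (lookup b) (pinch₃ i c)
    split₀-fibre = trans (cong (fibre split₀) (sym c≡ι))
                         (fibre-∘-injective (unpinch₃ i) (unpinch₃-injective i) (lookup b) (pinch₃ i c))
    mid≢c : mid₃ i ≢ c
    mid≢c refl = unpinch₃-avoids i (pinch₃-mid₃ i) (λ eq → left₃≢mid₃ i (sym eq)) c≡ι
    right≢c : right₃ i ≢ c
    right≢c refl = unpinch₃-avoids i (pinch₃-right₃ i) (λ eq → left₃≢right₃ i (sym eq)) c≡ι
  ... | inj₂ (inj₁ refl) = cong (_% 2) (fibre-split-new (pinch₃-mid₃ i) (left₃≢mid₃ i)
                                             (cong₂ _+_ (δ-≡ {a = mid₃ i} refl) (δ-≢ (λ eq → mid₃≢right₃ i (sym eq)))))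
  ... | inj₂ (inj₂ refl) = cong (_% 2) (fibre-split-new (pinch₃-right₃ i) (left₃≢right₃ i)
                                             (cong₂ _+_ (δ-≢ (mid₃≢right₃ i)) (δ-≡ {a = right₃ i} refl)))

u+2≤w⇒u≢w : ∀ {n} {u w : Fin n} → 2 + toℕ u ≤ toℕ w → u ≢ w
u+2≤w⇒u≢w u+2≤w refl = 1+n≰n (≤-trans (n≤1+n _) u+2≤w)

excess>0⇒split : ∀ {n} (x : OSP 2 n) → 0 < excess x → ∃ λ z → z ≤O x × nblocks z ≡ 2 + nblocks x
excess>0⇒split (osp k b valid) excess>0 =
  let i , three≤ = odd∧∑half>0⇒≥3 (fibre (lookup b)) (valid⇒oddFibres b valid) excess>0
      u , w , bu≡i , bw≡i , u+2≤w = fibre≥3⇒spread (lookup b) i three≤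
      open Split b i (u+2≤w⇒u≢w u+2≤w) bu≡i bw≡i
      b≡pinch₃-split : b ≡ map (pinch₃ i) (tabulate split)
      b≡pinch₃-split = trans (sym (tabulate∘lookup b))
                             (trans (tabulate-cong (λ q → sym (pinch₃-split q))) (tabulate-∘ (pinch₃ i) split))
  in osp (2 + k) (tabulate split) (tabulate-valid split (split-oddFibres (valid⇒oddFibres b valid))) ,
     (pinch₃ i , pinch₃-mono i , b≡pinch₃-split) , refl

-- Covers, chains and ranks

nblocks≢⇒just≢ : ∀ {n} {x y : OSP 2 n} → nblocks x ≢ nblocks y → just x ≢ just y
nblocks≢⇒just≢ kx≢ky refl = kx≢ky refl

nblocks≢1+nblocks : ∀ {n} (x y : OSP 2 n) → nblocks x ≢ suc (nblocks y)
nblocks≢1+nblocks x y kx≡1+ky = 1+2m≢2n (excess x) (excess y) (+-cancelˡ-≡ (nblocks y) _ _ (begin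
  nblocks y + suc (2 * excess x) ≡⟨ +-suc (nblocks y) _ ⟩
  suc (nblocks y) + 2 * excess x ≡⟨ cong (_+ 2 * excess x) kx≡1+ky ⟨
  nblocks x + 2 * excess x       ≡⟨ trans (sym (n≡nblocks+2*excess x)) (n≡nblocks+2*excess y) ⟩
  nblocks y + 2 * excess y       ∎))
  where open ≡-Reasoning

cover⇒nblocks≡2+ : ∀ {n} {x y : OSP 2 n} → just x ⋖ just y → nblocks x ≡ 2 + nblocks y
cover⇒nblocks≡2+ {x = x} {y} ((x≤y , x≢y) , nothing-between)
  with merge-between {x = x} {y} x≤y (≤∧≢⇒nblocks-< {x = x} {y} x≤y (λ x≡y → x≢y (cong just x≡y)))
... | z , x≤z , z≤y , kx≡2+kz with nblocks z ≟ nblocks y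
...   | yes kz≡ky = trans kx≡2+kz (cong (2 +_) kz≡ky)
...   | no kz≢ky = ⊥-elim (nothing-between (just z , (x≤z , x≢z) , (z≤y , nblocks≢⇒just≢ kz≢ky)))
  where
  x≢z : just x ≢ just z
  x≢z = nblocks≢⇒just≢ λ kx≡kz → m≢1+n+m (nblocks z) {1} (trans (sym kx≡kz) kx≡2+kz)

nblocks≡2+⇒cover : ∀ {n} {x y : OSP 2 n} → x ≤O y → nblocks x ≡ 2 + nblocks y → just x ⋖ just y
nblocks≡2+⇒cover {x = x} {y} x≤y kx≡2+ky = (x≤y , x≢y) , nothing-between
  where
  x≢y : just x ≢ just y
  x≢y = nblocks≢⇒just≢ λ kx≡ky → m≢1+n+m (nblocks y) {1} (trans (sym kx≡ky) kx≡2+ky)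
  nothing-between : ¬ (∃ λ z → (just x <Ω z) × (z <Ω just y))
  nothing-between (just z , (x≤z , x≢z) , (z≤y , z≢y)) = nblocks≢1+nblocks z y (≤-antisym kz≤1+ky 1+ky≤kz)
    where
    kz≤1+ky : nblocks z ≤ suc (nblocks y)
    kz≤1+ky = s≤s⁻¹ (subst (nblocks z <_) kx≡2+ky (≤∧≢⇒nblocks-< {x = x} {z} x≤z (λ eq → x≢z (cong just eq))))
    1+ky≤kz : suc (nblocks y) ≤ nblocks z
    1+ky≤kz = ≤∧≢⇒nblocks-< {x = z} {y} z≤y (λ eq → z≢y (cong just eq))

chain⇒nblocks : ∀ {n} {x y : OSP 2 n} {r} → SatChain (just x) (just y) r → nblocks x ≡ 2 * r + nblocks y
chain⇒nblocks done = refl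
chain⇒nblocks (step {z = nothing} ((x≤0̂ , _) , _) _) = ⊥-elim x≤0̂
chain⇒nblocks {x = x} {y} (step {z = just z} {r = r} x⋖z rest) = begin
  nblocks x                    ≡⟨ cover⇒nblocks≡2+ x⋖z ⟩
  2 + nblocks z                ≡⟨ cong (2 +_) (chain⇒nblocks rest) ⟩
  2 + (2 * r + nblocks y)      ≡⟨ +-assoc 2 (2 * r) (nblocks y) ⟨
  (2 + 2 * r) + nblocks y      ≡⟨ cong (_+ nblocks y) (*-suc 2 r) ⟨
  2 * suc r + nblocks y        ∎
  where open ≡-Reasoning

nblocks⇒chain : ∀ {n} d {x y : OSP 2 n} → x ≤O y → nblocks x ≡ 2 * d + nblocks y → SatChain (just x) (just y) d
nblocks⇒chain zero {x} {y} x≤y kx≡ky =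
  subst (λ z → SatChain (just x) (just z) 0) (≤∧nblocks≡⇒≡ {x = x} {y} x≤y kx≡ky) done
nblocks⇒chain (suc d) {x} {y} x≤y kx≡ =
  let z , x≤z , z≤y , kx≡2+kz = merge-between {x = x} {y} x≤y ky<kx
      kz≡ : nblocks z ≡ 2 * d + nblocks y
      kz≡ = +-cancelˡ-≡ 2 _ _ (trans (sym kx≡2+kz) kx≡2+)
  in step (nblocks≡2+⇒cover {x = x} {z} x≤z kx≡2+kz) (nblocks⇒chain d {z} {y} z≤y kz≡)
  where
  kx≡2+ : nblocks x ≡ 2 + (2 * d + nblocks y)
  kx≡2+ = trans kx≡ (trans (cong (_+ nblocks y) (*-suc 2 d)) (+-assoc 2 (2 * d) (nblocks y)))
  ky<kx : nblocks y < nblocks x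
  ky<kx = subst (nblocks y <_) (sym kx≡2+) (s≤s (m≤n+m (nblocks y) (suc (2 * d))))

-- A block with three points splits into three, giving an element strictly between 0̂ and the atom.
atom⇒excess≡0 : ∀ {n} {a : OSP 2 n} → IsAtom (just a) → excess a ≡ 0
atom⇒excess≡0 {a = a} (_ , nothing-between) = n≤0⇒n≡0 (≮⇒≥ λ excess>0 →
  let z , z≤a , kz≡2+ka = excess>0⇒split a excess>0
      z≢a = nblocks≢⇒just≢ λ kz≡ka → m≢1+n+m (nblocks a) {1} (trans (sym kz≡ka) kz≡2+ka)
  in nothing-between (just z , (_ , λ ()) , (z≤a , z≢a)))

atom⇒n≡nblocks : ∀ {n} {a : OSP 2 n} → IsAtom (just a) → n ≡ nblocks a
atom⇒n≡nblocks {a = a} atom =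
  trans (n≡nblocks+2*excess a) (trans (cong (λ e → nblocks a + 2 * e) (atom⇒excess≡0 atom)) (+-identityʳ _))

rank≡1+excess : ∀ {n} {y : OSP 2 n} {r} → HasRank (just y) r → r ≡ suc (excess y)
rank≡1+excess (step {z = nothing} ((_ , 0̂≢0̂) , _) _) = ⊥-elim (0̂≢0̂ refl)
rank≡1+excess {n} {y} (step {z = just a} {r = r} 0̂⋖a rest) =
  cong suc (*-cancelˡ-≡ r (excess y) 2 (+-cancelʳ-≡ (nblocks y) _ _ (begin
    2 * r + nblocks y         ≡⟨ chain⇒nblocks rest ⟨
    nblocks a                 ≡⟨ atom⇒n≡nblocks 0̂⋖a ⟨
    n                         ≡⟨ n≡nblocks+2*excess y ⟩
    nblocks y + 2 * excess y  ≡⟨ +-comm (nblocks y) _ ⟩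
    2 * excess y + nblocks y  ∎)))
  where open ≡-Reasoning

above-atom⇒rank : ∀ {n} {a y : OSP 2 n} → IsAtom (just a) → a ≤O y → HasRank (just y) (suc (excess y))
above-atom⇒rank {n} {a} {y} 0̂⋖a a≤y = step 0̂⋖a (nblocks⇒chain (excess y) {a} {y} a≤y ka≡)
  where
  ka≡ : nblocks a ≡ 2 * excess y + nblocks y
  ka≡ = trans (sym (atom⇒n≡nblocks 0̂⋖a)) (trans (n≡nblocks+2*excess y) (+-comm (nblocks y) _))

-- Compositions into odd parts

IsOddComposition : ∀ {N p} → Vec (Fin p) N → Set
IsOddComposition w = Monotone (lookup w) × (∀ j → Odd (blockSize w j))

newBlock : ∀ {n p} → Vec (Fin p) n → Vec (Fin (suc p)) (suc n)
newBlock w = zero ∷ map suc w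

growBlock : ∀ {n p} → Vec (Fin (suc p)) n → Vec (Fin (suc p)) (2 + n)
growBlock w = zero ∷ zero ∷ w

-- Lists the vectors w with IsOddComposition w, i.e. the compositions of N into
-- p odd parts, according to whether the first part is 1 (newBlock) or larger (growBlock).
oddCompositions : (N p : ℕ) → List (Vec (Fin p) N)
oddCompositions zero zero = [] ∷ []
oddCompositions zero (suc p) = []
oddCompositions (suc N) zero = []
oddCompositions (suc zero) (suc p) = L.map newBlock (oddCompositions zero p)
oddCompositions (suc (suc N)) (suc p) =
  L.map newBlock (oddCompositions (suc N) p) L.++ L.map growBlock (oddCompositions N (suc p))

¬Odd0 : ¬ Odd 0
¬Odd0 ()

blockSize-map-suc-zero : ∀ {n p} (w : Vec (Fin p) n) → blockSize (map suc w) zero ≡ 0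
blockSize-map-suc-zero [] = refl
blockSize-map-suc-zero (_ ∷ w) = blockSize-map-suc-zero w

blockSize-map-suc : ∀ {n p} (w : Vec (Fin p) n) j → blockSize (map suc w) (suc j) ≡ blockSize w j
blockSize-map-suc [] j = refl
blockSize-map-suc (x ∷ w) j with x ≟F j
... | yes _ = cong suc (blockSize-map-suc w j)
... | no _ = blockSize-map-suc w j

newBlock-odd : ∀ {n p} {w : Vec (Fin p) n} → IsOddComposition w → IsOddComposition (newBlock w)
newBlock-odd {w = w} (mono , odd) = mono′ , odd′
  where
  mono′ : Monotone (lookup (newBlock w))
  mono′ zero j _ = z≤n
  mono′ (suc i) (suc j) (s≤s i≤j) = subst₂ F._≤_ (sym (lookup-map i suc w)) (sym (lookup-map j suc w)) (s≤s (mono i j i≤j))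
  odd′ : ∀ j → Odd (blockSize (newBlock w) j)
  odd′ zero = cong (λ s → suc s % 2) (blockSize-map-suc-zero w)
  odd′ (suc j) = trans (cong (_% 2) (blockSize-map-suc w j)) (odd j)

growBlock-odd : ∀ {n p} {w : Vec (Fin (suc p)) n} → IsOddComposition w → IsOddComposition (growBlock w)
growBlock-odd {w = w} (mono , odd) = mono′ , odd′
  where
  mono′ : Monotone (lookup (growBlock w))
  mono′ zero j _ = z≤n
  mono′ (suc zero) (suc j) _ = z≤n
  mono′ (suc (suc i)) (suc (suc j)) (s≤s (s≤s i≤j)) = mono i j i≤j
  odd′ : ∀ j → Odd (blockSize (growBlock w) j)
  odd′ zero = odd zero
  odd′ (suc j) = odd (suc j)

newBlock-odd⁻ : ∀ {n p} {w : Vec (Fin p) n} → IsOddComposition (newBlock w) → IsOddComposition w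
newBlock-odd⁻ {w = w} (mono , odd) = mono′ , odd′
  where
  mono′ : Monotone (lookup w)
  mono′ i j i≤j = s≤s⁻¹ (subst₂ F._≤_ (lookup-map i suc w) (lookup-map j suc w) (mono (suc i) (suc j) (s≤s i≤j)))
  odd′ : ∀ j → Odd (blockSize w j)
  odd′ j = trans (cong (_% 2) (sym (blockSize-map-suc w j))) (odd (suc j))

growBlock-odd⁻ : ∀ {n p} {w : Vec (Fin (suc p)) n} → IsOddComposition (growBlock w) → IsOddComposition w
growBlock-odd⁻ {w = w} (mono , odd) = mono′ , odd′
  where
  mono′ : Monotone (lookup w)
  mono′ i j i≤j = mono (suc (suc i)) (suc (suc j)) (s≤s (s≤s i≤j))
  odd′ : ∀ j → Odd (blockSize w j)
  odd′ zero = odd zero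
  odd′ (suc j) = odd (suc j)

oddComposition-head : ∀ {n p} {x : Fin (suc p)} {w : Vec (Fin (suc p)) n} → IsOddComposition (x ∷ w) → x ≡ zero
oddComposition-head {x = x} {w} (mono , odd) = FP.toℕ-injective (n≤0⇒n≡0 (subst (λ c → x F.≤ c) vq≡0 (mono zero q z≤n)))
  where
  ∃q = fibre>0⇒∈image (lookup (x ∷ w)) zero
         (subst (0 <_) (blockSize≡fibre (x ∷ w) zero) (odd⇒>0 {blockSize (x ∷ w) zero} (odd zero)))
  q = proj₁ ∃q
  vq≡0 : lookup (x ∷ w) q ≡ zero
  vq≡0 = proj₂ ∃q

map-suc⁻¹ : ∀ {n p} (v : Vec (Fin (suc p)) n) → (∀ q → lookup v q ≢ zero) → ∃ λ w → map suc w ≡ v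
map-suc⁻¹ [] _ = [] , refl
map-suc⁻¹ (zero ∷ v) nonzero = ⊥-elim (nonzero zero refl)
map-suc⁻¹ (suc a ∷ v) nonzero = let w , eq = map-suc⁻¹ v (λ q → nonzero (suc q)) in a ∷ w , cong (suc a ∷_) eq

map-sound : ∀ {N N′ p p′} {f : Vec (Fin p′) N′ → Vec (Fin p) N} {ws : List (Vec (Fin p′) N′)} →
            (∀ {w} → IsOddComposition w → IsOddComposition (f w)) →
            (∀ {w} → w ∈ ws → IsOddComposition w) → ∀ {w} → w ∈ L.map f ws → IsOddComposition w
map-sound {f = f} f-odd ws-odd w∈ =
  let w′ , w′∈ , w≡fw′ = ∈-map⁻ f w∈ in subst IsOddComposition (sym w≡fw′) (f-odd (ws-odd w′∈))

oddCompositions-sound : ∀ N p {w} → w ∈ oddCompositions N p → IsOddComposition w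
oddCompositions-sound zero zero (here refl) = (λ ()) , (λ ())
oddCompositions-sound (suc zero) (suc p) w∈ = map-sound newBlock-odd (oddCompositions-sound zero p) w∈
oddCompositions-sound (suc (suc N)) (suc p) w∈ with ∈-++⁻ (L.map newBlock (oddCompositions (suc N) p)) w∈
... | inj₁ w∈new = map-sound newBlock-odd (oddCompositions-sound (suc N) p) w∈new
... | inj₂ w∈grow = map-sound growBlock-odd (oddCompositions-sound N (suc p)) w∈grow

oddCompositions-complete : ∀ N p (w : Vec (Fin p) N) → IsOddComposition w → w ∈ oddCompositions N p
oddCompositions-complete zero zero [] _ = here refl
oddCompositions-complete zero (suc p) [] (_ , odd) = ⊥-elim (¬Odd0 (odd zero))
oddCompositions-complete (suc N) (suc p) (suc x ∷ w) odd with () ← oddComposition-head odd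
oddCompositions-complete (suc zero) (suc zero) (zero ∷ []) _ = here refl
oddCompositions-complete (suc zero) (suc (suc p)) (zero ∷ []) (_ , odd) = ⊥-elim (¬Odd0 (odd (suc zero)))
oddCompositions-complete (suc (suc N)) (suc p) (zero ∷ zero ∷ w) odd =
  ∈-++⁺ʳ (L.map newBlock (oddCompositions (suc N) p))
         (∈-map⁺ growBlock (oddCompositions-complete N (suc p) w (growBlock-odd⁻ odd)))
oddCompositions-complete (suc (suc N)) (suc p) (zero ∷ suc y ∷ w) odd =
  let w′ , map-suc-w′≡ = map-suc⁻¹ (suc y ∷ w) nonzero
      odd′ = newBlock-odd⁻ (subst (λ v → IsOddComposition (zero ∷ v)) (sym map-suc-w′≡) odd)
  in subst (λ v → zero ∷ v ∈ oddCompositions (suc (suc N)) (suc p)) map-suc-w′≡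
           (∈-++⁺ˡ (∈-map⁺ newBlock (oddCompositions-complete (suc N) p w′ odd′)))
  where
  nonzero : ∀ q → lookup (suc y ∷ w) q ≢ zero
  nonzero q vq≡0 =
    1+n≰n (subst (λ c → 1 ≤ toℕ c) vq≡0 (≤-trans (s≤s z≤n) (proj₁ odd (suc zero) (suc q) (s≤s z≤n))))

map-suc-injective : ∀ {n p} {w w′ : Vec (Fin p) n} → map F.suc w ≡ map F.suc w′ → w ≡ w′
map-suc-injective {w = []} {[]} _ = refl
map-suc-injective {w = _ ∷ _} {_ ∷ _} eq =
  cong₂ _∷_ (FP.suc-injective (∷-injectiveˡ eq)) (map-suc-injective (∷-injectiveʳ eq))

oddCompositions-unique : ∀ N p → Unique (oddCompositions N p)
oddCompositions-unique zero zero = [] ∷ []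
oddCompositions-unique zero (suc p) = []
oddCompositions-unique (suc N) zero = []
oddCompositions-unique (suc zero) (suc p) =
  UP.map⁺ (λ eq → map-suc-injective (∷-injectiveʳ eq)) (oddCompositions-unique zero p)
oddCompositions-unique (suc (suc N)) (suc p) =
  UP.++⁺ (UP.map⁺ (λ eq → map-suc-injective (∷-injectiveʳ eq)) (oddCompositions-unique (suc N) p))
         (UP.map⁺ (λ eq → ∷-injectiveʳ (∷-injectiveʳ eq)) (oddCompositions-unique N (suc p)))
         disjoint
  where
  disjoint : ∀ {v} → ¬ (v ∈ L.map newBlock (oddCompositions (suc N) p) × v ∈ L.map growBlock (oddCompositions N (suc p)))
  disjoint (v∈new , v∈grow) with ∈-map⁻ newBlock v∈new | ∈-map⁻ growBlock v∈grow
  ... | (_ ∷ _) , _ , v≡new | _ , _ , v≡grow with trans (sym v≡new) v≡grow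
  ... | ()

length-oddCompositions-step : ∀ N p → length (oddCompositions (2 + N) (suc p)) ≡
                              length (oddCompositions (suc N) p) + length (oddCompositions N (suc p))
length-oddCompositions-step N p =
  trans (length-++ (L.map newBlock (oddCompositions (suc N) p)))
        (cong₂ _+_ (length-map newBlock (oddCompositions (suc N) p)) (length-map growBlock (oddCompositions N (suc p))))

length-oddCompositions-< : ∀ N p → N < p → length (oddCompositions N p) ≡ 0
length-oddCompositions-< zero (suc p) _ = refl
length-oddCompositions-< (suc zero) (suc p) (s≤s 0<p) =
  trans (length-map newBlock (oddCompositions zero p)) (length-oddCompositions-< zero p 0<p)
length-oddCompositions-< (suc (suc N)) (suc p) (s≤s 1+N<p) =
  trans (length-oddCompositions-step N p)
        (cong₂ _+_ (length-oddCompositions-< (suc N) p 1+N<p)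
                   (length-oddCompositions-< N (suc p) (<-trans (n<1+n N) (m<n⇒m<1+n 1+N<p))))

length-oddCompositions : ∀ t p → length (oddCompositions (suc p + 2 * t) (suc p)) ≡ (p + t) C p
length-oddCompositions′ : ∀ t p → length (oddCompositions (p + 2 * t) (2 + p)) ≡ (p + t) C suc p

length-oddCompositions zero zero = refl
length-oddCompositions (suc t) zero = begin
  length (oddCompositions (2 + (t + suc (t + 0))) 1)   ≡⟨ length-oddCompositions-step (t + suc (t + 0)) 0 ⟩
  length (oddCompositions (t + suc (t + 0)) 1)         ≡⟨ cong (λ N → length (oddCompositions N 1)) (+-suc t (t + 0)) ⟩
  length (oddCompositions (suc (2 * t)) 1)             ≡⟨ length-oddCompositions t zero ⟩
  1                                                    ∎
  where open ≡-Reasoning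
length-oddCompositions t (suc p) = begin
  length (oddCompositions (2 + (p + 2 * t)) (2 + p))   ≡⟨ length-oddCompositions-step (p + 2 * t) (suc p) ⟩
  length (oddCompositions (suc p + 2 * t) (suc p)) + length (oddCompositions (p + 2 * t) (2 + p))
                                                       ≡⟨ cong₂ _+_ (length-oddCompositions t p) (length-oddCompositions′ t p) ⟩
  (p + t) C p + (p + t) C suc p                        ≡⟨ nCk+nC[k+1]≡[n+1]C[k+1] (p + t) p ⟩
  suc (p + t) C suc p                                  ∎
  where open ≡-Reasoning

length-oddCompositions′ zero p = begin
  length (oddCompositions (p + 0) (2 + p))   ≡⟨ length-oddCompositions-< (p + 0) (2 + p) (s≤s (m≤n⇒m≤1+n (≤-reflexive (+-identityʳ p)))) ⟩
  0                                          ≡⟨ k>n⇒nCk≡0 (s≤s (≤-reflexive (+-identityʳ p))) ⟨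
  (p + 0) C suc p                            ∎
  where open ≡-Reasoning
length-oddCompositions′ (suc t) p = begin
  length (oddCompositions (p + 2 * suc t) (2 + p))       ≡⟨ cong (λ N → length (oddCompositions N (2 + p))) p+2+2t≡ ⟩
  length (oddCompositions (suc (suc p) + 2 * t) (2 + p)) ≡⟨ length-oddCompositions t (suc p) ⟩
  (suc p + t) C suc p                                    ≡⟨ cong (_C suc p) (+-suc p t) ⟨
  (p + suc t) C suc p                                    ∎
  where
  open ≡-Reasoning
  p+2+2t≡ : p + 2 * suc t ≡ suc (suc p) + 2 * t
  p+2+2t≡ = solve-∀′ p t
    where
    solve-∀′ : ∀ p t → p + 2 * suc t ≡ suc (suc p) + 2 * t
    solve-∀′ = solve-∀

length-oddCompositions-odd : ∀ m k → length (oddCompositions (suc (2 * m)) (suc (2 * k))) ≡ (m + k) C (2 * k)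
length-oddCompositions-odd m k with k ≤? m
... | yes k≤m = begin
  length (oddCompositions (suc (2 * m)) (suc (2 * k)))       ≡⟨ cong (λ N → length (oddCompositions (suc N) (suc (2 * k)))) 2m≡ ⟩
  length (oddCompositions (suc (2 * k) + 2 * t) (suc (2 * k))) ≡⟨ length-oddCompositions t (2 * k) ⟩
  (2 * k + t) C (2 * k)                                      ≡⟨ cong (_C (2 * k)) 2k+t≡ ⟩
  (m + k) C (2 * k)                                          ∎
  where
  open ≡-Reasoning
  t = m ∸ k
  m≡t+k : m ≡ t + k
  m≡t+k = sym (m∸n+n≡m k≤m)
  2m≡ : 2 * m ≡ 2 * k + 2 * t
  2m≡ = trans (cong (2 *_) m≡t+k) (rearrange t k)
    where
    rearrange : ∀ t k → 2 * (t + k) ≡ 2 * k + 2 * t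
    rearrange = solve-∀
  2k+t≡ : 2 * k + t ≡ m + k
  2k+t≡ = trans (rearrange t k) (cong (_+ k) (sym m≡t+k))
    where
    rearrange : ∀ t k → 2 * k + t ≡ (t + k) + k
    rearrange = solve-∀
... | no k≰m = trans (length-oddCompositions-< (suc (2 * m)) (suc (2 * k)) (s≤s (*-monoʳ-< 2 m<k)))
                     (sym (k>n⇒nCk≡0 m+k<2k))
  where
  m<k : m < k
  m<k = ≰⇒> k≰m
  m+k<2k : m + k < 2 * k
  m+k<2k = subst (m + k <_) (cong (k +_) (sym (+-identityʳ k))) (+-monoˡ-< k m<k)

-- The interval above an atom

Unique-map⁺-∈ : ∀ {A B : Set} {f : A → B} {xs : List A} →
                (∀ {x y} → x ∈ xs → y ∈ xs → f x ≡ f y → x ≡ y) → Unique xs → Unique (L.map f xs)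
Unique-map⁺-∈ {xs = []} _ [] = []
Unique-map⁺-∈ {f = f} {x ∷ xs} inj (x∉xs ∷ unique) =
  All.tabulate fx∉ ∷ Unique-map⁺-∈ (λ x∈ y∈ → inj (there x∈) (there y∈)) unique
  where
  fx∉ : ∀ {v} → v ∈ L.map f xs → f x ≢ v
  fx∉ v∈ fx≡v = let y , y∈xs , v≡fy = ∈-map⁻ f v∈ in
    All.lookup x∉xs y∈xs (inj (here refl) (there y∈xs) (trans fx≡v v≡fy))

-- Total so that it can be mapped over a list; only used on valid vectors (fromBlocks-valid).
fromBlocks : ∀ {n k} → Vec (Fin k) n → Ω̆ 2 n
fromBlocks v with T? (validᵇ 2 v)
... | yes valid = just (osp _ v valid)
... | no _ = nothing

fromBlocks-valid : ∀ {n k} (v : Vec (Fin k) n) (valid : T (validᵇ 2 v)) → fromBlocks v ≡ just (osp _ v valid)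
fromBlocks-valid v valid with T? (validᵇ 2 v)
... | yes _ = cong just (osp-≡ refl)
... | no invalid = ⊥-elim (invalid valid)

blocks-surjective : ∀ {n} (x : OSP 2 n) i → ∃ λ q → lookup (blocks x) q ≡ i
blocks-surjective x i = fibre>0⇒∈image (lookup (blocks x)) i (odd⇒>0 {fibre (lookup (blocks x)) i} (blocks-odd x i))

≤-one-block : ∀ {n} {x y : OSP 2 n} → nblocks y ≡ 1 → x ≤O y
≤-one-block {x = x} {osp 1 b _} refl = (λ _ → zero) , (λ _ _ _ → z≤n) , constant b (blocks x)
  where
  constant : ∀ {n} {A : Set} (b : Vec (Fin 1) n) (c : Vec A n) → b ≡ map (λ _ → zero) c
  constant [] [] = refl
  constant (zero ∷ b) (_ ∷ c) = cong (zero ∷_) (constant b c)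

one-block-excess : ∀ {m} (y : OSP 2 (suc (2 * m))) → nblocks y ≡ 1 → excess y ≡ m
one-block-excess {m} y ky≡1 =
  sym (*-cancelˡ-≡ m (excess y) 2 (suc-injective (trans (n≡nblocks+2*excess y) (cong (_+ 2 * excess y) ky≡1))))

corank-arithmetic : ∀ {m K e} k → suc (2 * m) ≡ K + 2 * e → m ≡ e + k ⇔ K ≡ suc (2 * k)
corank-arithmetic {m} {K} {e} k 1+2m≡ = mk⇔ to from
  where
  expand : ∀ e k → suc (2 * (e + k)) ≡ suc (2 * k) + 2 * e
  expand = solve-∀
  to : m ≡ e + k → K ≡ suc (2 * k)
  to m≡e+k = +-cancelʳ-≡ (2 * e) K _ (trans (sym 1+2m≡) (trans (cong (λ t → suc (2 * t)) m≡e+k) (expand e k)))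
  from : K ≡ suc (2 * k) → m ≡ e + k
  from K≡ = *-cancelˡ-≡ m (e + k) 2 (suc-injective (trans 1+2m≡ (trans (cong (_+ 2 * e) K≡) (sym (expand e k)))))

module AboveAtom (m : ℕ) {α : OSP 2 (suc (2 * m))} (atom : IsAtom (just α)) (k : ℕ) where

  -- The validity proof inside 1̂ is private to Defs; unification recovers it.
  1̂-is-just : ∃ λ top → 1̂ m ≡ just top
  1̂-is-just = _ , refl

  top : OSP 2 (suc (2 * m))
  top = proj₁ 1̂-is-just

  rank-1̂ : ∀ {s} → HasRank (1̂ m) s → s ≡ suc m
  rank-1̂ hs = trans (rank≡1+excess {y = top} hs) (cong suc (one-block-excess top refl))

  1̂-rank : HasRank (1̂ m) (suc m)
  1̂-rank = subst (λ e → HasRank (1̂ m) (suc e)) (one-block-excess top refl)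
                 (above-atom⇒rank atom (≤-one-block {x = α} {top} refl))

  corank⇔ : ∀ {ψ} → α ≤O ψ → Crk m (just ψ) k ⇔ nblocks ψ ≡ suc (2 * k)
  corank⇔ {ψ} α≤ψ = mk⇔ (λ crk → to arith (m≡excess+k crk))
                         (λ kψ≡ → _ , _ , above-atom⇒rank atom α≤ψ , 1̂-rank , cong suc (from arith kψ≡))
    where
    open Equivalence
    arith = corank-arithmetic k (n≡nblocks+2*excess ψ)
    m≡excess+k : Crk m (just ψ) k → m ≡ excess ψ + k
    m≡excess+k (r , s , hr , hs , s≡r+k) =
      suc-injective (trans (sym (rank-1̂ hs)) (trans s≡r+k (cong (_+ k) (rank≡1+excess hr))))

  p : ℕ
  p = suc (2 * k)

  B : Vec (Fin (nblocks α)) (suc (2 * m))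
  B = blocks α

  compositionPartition : Vec (Fin p) (nblocks α) → Ω̆ 2 (suc (2 * m))
  compositionPartition w = fromBlocks (map (lookup w) B)

  interval : List (Ω̆ 2 (suc (2 * m)))
  interval = L.map compositionPartition (oddCompositions (nblocks α) p)

  composition-valid : ∀ (w : Vec (Fin p) (nblocks α)) → IsOddComposition w → T (validᵇ 2 (map (lookup w) B))
  composition-valid w (_ , odd) = map-valid B (λ j → subst Odd (blockSize≡fibre w j) (odd j)) (valid α)

  interval-unique : Unique interval
  interval-unique = Unique-map⁺-∈ injective (oddCompositions-unique (nblocks α) p)
    where
    injective : ∀ {w w′} → w ∈ oddCompositions (nblocks α) p → w′ ∈ oddCompositions (nblocks α) p →
                compositionPartition w ≡ compositionPartition w′ → w ≡ w′
    injective {w} {w′} w∈ w′∈ eq = trans (sym (tabulate∘lookup w)) (trans (tabulate-cong pointwise) (tabulate∘lookup w′))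
      where
      same-blocks : map (lookup w) B ≡ map (lookup w′) B
      same-blocks = osp-injective (just-injective (trans (sym (fromBlocks-valid (map (lookup w) B) w-valid))
                                                         (trans eq (fromBlocks-valid (map (lookup w′) B) w′-valid))))
        where
        w-valid : T (validᵇ 2 (map (lookup w) B))
        w-valid = composition-valid w (oddCompositions-sound _ _ w∈)
        w′-valid : T (validᵇ 2 (map (lookup w′) B))
        w′-valid = composition-valid w′ (oddCompositions-sound _ _ w′∈)
      pointwise : ∀ i → lookup w i ≡ lookup w′ i
      pointwise i = let q , Bq≡i = blocks-surjective α i in
        subst (λ c → lookup w c ≡ lookup w′ c) Bq≡i
              (trans (sym (lookup-map q (lookup w) B)) (trans (cong (λ v → lookup v q) same-blocks) (lookup-map q (lookup w′) B)))

  InInterval : Ω̆ 2 (suc (2 * m)) → Set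
  InInterval ω = (just α ≤Ω ω) × (ω ≤Ω 1̂ m) × Crk m ω k

  interval-sound : ∀ {ω} → ω ∈ interval → InInterval ω
  interval-sound ω∈ with ∈-map⁻ compositionPartition ω∈
  ... | w , w∈ , refl = subst InInterval (sym (fromBlocks-valid (map (lookup w) B) ψ-valid))
                              (α≤ψ , ≤-one-block {x = ψ} {top} refl , Equivalence.from (corank⇔ α≤ψ) refl)
    where
    odd : IsOddComposition w
    odd = oddCompositions-sound _ _ w∈
    ψ-valid : T (validᵇ 2 (map (lookup w) B))
    ψ-valid = composition-valid w odd
    ψ : OSP 2 (suc (2 * m))
    ψ = osp p (map (lookup w) B) ψ-valid
    α≤ψ : α ≤O ψ
    α≤ψ = lookup w , proj₁ odd , refl

  interval-complete : ∀ ω → InInterval ω → ω ∈ interval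
  interval-complete (just (osp l b v)) (α≤ψ@(g , mono , b≡gB) , _ , crk) with Equivalence.to (corank⇔ α≤ψ) crk
  ... | refl = subst (_∈ interval) w↦ψ (∈-map⁺ compositionPartition (oddCompositions-complete _ _ w odd))
    where
    w : Vec (Fin p) (nblocks α)
    w = tabulate g
    odd : IsOddComposition w
    odd = mono′ , odd′
      where
      mono′ : Monotone (lookup w)
      mono′ i j i≤j = subst₂ F._≤_ (sym (lookup∘tabulate g i)) (sym (lookup∘tabulate g j)) (mono i j i≤j)
      odd′ : ∀ j → Odd (blockSize w j)
      odd′ j = subst Odd (sym (trans (blockSize≡fibre w j) (fibre-cong (lookup∘tabulate g) j)))
                     (≤-oddFibres {x = α} {osp l b v} α≤ψ j)
    w↦ψ : compositionPartition w ≡ just (osp l b v)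
    w↦ψ = trans (fromBlocks-valid (map (lookup w) B) (composition-valid w odd))
                (cong just (osp-≡ (sym (trans b≡gB (map-cong (λ i → sym (lookup∘tabulate g i)) B)))))

  interval-length : length interval ≡ (m + k) C (2 * k)
  interval-length = begin
    length interval                             ≡⟨ length-map compositionPartition (oddCompositions (nblocks α) p) ⟩
    length (oddCompositions (nblocks α) p)      ≡⟨ cong (λ K → length (oddCompositions K p)) (atom⇒n≡nblocks atom) ⟨
    length (oddCompositions (suc (2 * m)) p)    ≡⟨ length-oddCompositions-odd m k ⟩
    (m + k) C (2 * k)                           ∎
    where open ≡-Reasoning

mainTheorem15 : (m : ℕ) (a : Ω̆ 2 (suc (2 * m))) → IsAtom a → (k : ℕ) →
    Σ (List (Ω̆ 2 (suc (2 * m)))) λ L →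
      Unique L
      × ((ω : Ω̆ 2 (suc (2 * m))) → (ω ∈ L) ⇔ ((a ≤Ω ω) × (ω ≤Ω 1̂ m) × Crk m ω k))
      × (length L ≡ (m + k) C (2 * k))
mainTheorem15 m nothing ((_ , 0̂≢0̂) , _) k = ⊥-elim (0̂≢0̂ refl)
mainTheorem15 m (just α) atom k =
  interval , interval-unique , (λ ω → mk⇔ interval-sound (interval-complete ω)) , interval-length
  where open AboveAtom m atom k
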